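{- Let $k>1$ be an integer. The largest even positive integer $n$ with $\lambda(n)=k$ is $2^{k+1}$, and every odd positive integer $n$ with $\lambda(n)=k$ satisfies $n<2^k$.
   Context: Let $\overline{\psi}$ be the multiplicative arithmetic function with $\overline{\psi}(p^{\alpha})=p^{\alpha-1}(p+1)$ for odd primes $p$ and $\overline{\psi}(2^{\alpha})=2^{\alpha-1}$, for all positive integers $\alpha$ (so $\overline{\psi}(1)=1$). For $n>1$, $\lambda(n)$ is the unique nonnegative integer with $\overline{\psi}^{\lambda(n)}(n)=2$ (where $\overline{\psi}^k$ is the $k$-th iterate, $\overline{\psi}^0(n)=n$), and $\lambda(1)=0$. -}

module Defs where

open import Data.Nat using (ℕ; zero; suc; _+_; _*_; _∸_; _^_; _<_; _≤_)
open import Data.Nat.Divisibility using (_∣_)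
open import Data.Nat.Primality using (Prime)
open import Data.Nat.Coprimality using (Coprime)
open import Data.Product using (_×_)
open import Data.Sum using (_⊎_)
open import Relation.Nullary using (¬_)
open import Relation.Binary.PropositionalEquality using (_≡_)

iter : (ℕ → ℕ) → ℕ → ℕ → ℕ
iter f zero    n = n
iter f (suc k) n = f (iter f k n)

-- f is the multiplicative arithmetic function ψ̄ of the paper:
-- multiplicative (f 1 = 1, f (m n) = f m f n for coprime m, n), with
-- f(p^α) = p^(α-1)(p+1) for odd primes p and f(2^α) = 2^(α-1), α ≥ 1.
-- These properties determine f uniquely on the positive integers.
record IsPsiBar (f : ℕ → ℕ) : Set where
  field
    one      : f 1 ≡ 1
    mult     : ∀ m n → 0 < m → 0 < n → Coprime m n → f (m * n) ≡ f m * f n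
    oddPrime : ∀ p α → Prime p → ¬ (2 ∣ p) → 1 ≤ α →
               f (p ^ α) ≡ p ^ (α ∸ 1) * (p + 1)
    twoPow   : ∀ α → 1 ≤ α → f (2 ^ α) ≡ 2 ^ (α ∸ 1)

HasLambda : (ℕ → ℕ) → ℕ → ℕ → Set
HasLambda f n k = (n ≡ 1 × k ≡ 0) ⊎ (1 < n × iter f k n ≡ 2)

{-# OPTIONS --safe #-}
module Submission where

-- ψ̄ at most halves any n > 0 (n ≤ 2 ψ̄(n)) and strictly increases odd n > 1: splitting
-- off a power of an odd prime p, ψ̄(p^(1+a) r) = p^a (p+1) ψ̄(r) ≥ p^(1+a) r + p^a r, using
-- r ≤ ψ̄(r) for the odd cofactor r by well-founded induction. Going down the orbit,
-- ψ̄^k(n) = 2 therefore forces n ≤ 2^(k+1), and for odd n the first step n < ψ̄(n) ≤ 2^k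
-- improves this to n < 2^k. The bound 2^(k+1) is attained since ψ̄ halves powers of 2.

open import Defs
open import Data.Nat using (ℕ; zero; suc; _+_; _*_; _^_; _<_; _≤_; z≤n; s≤s; z<s; >-nonZero; >-nonZero⁻¹; n>1⇒nonTrivial; nonTrivial⇒n>1)
open import Data.Nat.Properties
open import Data.Nat.Divisibility
open import Data.Nat.Primality using (Prime; prime[2]; prime⇒irreducible; prime⇒nonZero; prime⇒nonTrivial)
open import Data.Nat.Primality.Factorisation using (factorise)
open import Data.Nat.Coprimality using (Coprime; coprime-divisor) renaming (sym to coprime-sym)
open import Data.Nat.ListAction using (product)
open import Data.Nat.Induction using (<-wellFounded)
open import Data.Nat.Solver using (module +-*-Solver)
open import Induction.WellFounded using (Acc; acc)
open import Data.List using ([]; _∷_)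
open import Data.List.Relation.Unary.All using (_∷_)
open import Data.Product using (∃; ∃₂; _×_; _,_)
open import Data.Sum using (inj₁; inj₂)
open import Relation.Nullary using (¬_; yes; no; contradiction)
open import Relation.Binary.PropositionalEquality using (_≡_; refl; sym; trans; cong; subst; module ≡-Reasoning)

m*n>0⇒n>0 : ∀ m {n} → 0 < m * n → 0 < n
m*n>0⇒n>0 m {zero}  m*0>0 = contradiction (*-zeroʳ m) (>⇒≢ m*0>0)
m*n>0⇒n>0 m {suc n} _     = z<s

n<m^[1+a]*n : ∀ {m n} a → 1 < m → 0 < n → n < m ^ suc a * n
n<m^[1+a]*n {m} {n@(suc _)} a 1<m _ =
  subst (n <_) (*-comm n (m ^ suc a)) (m<m*n n (m ^ suc a) (^-monoʳ-< m 1<m {0} {suc a} z<s))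

prime>1 : ∀ {p} → Prime p → 1 < p
prime>1 {p} p-prime = nonTrivial⇒n>1 p {{prime⇒nonTrivial p-prime}}

∃-prime-divisor : ∀ {n} → 1 < n → ∃ λ p → Prime p × p ∣ n
∃-prime-divisor {n@(suc _)} 1<n with factorise n
... | record { factors = [] ; isFactorisation = n≡1 } = contradiction n≡1 (>⇒≢ 1<n)
... | record { factors = p ∷ ps ; isFactorisation = n≡p*ps ; factorsPrime = p-prime ∷ _ } =
  p , p-prime , divides (product ps) (trans n≡p*ps (*-comm p (product ps)))

coprime-* : ∀ {m n o} → Coprime m n → Coprime m o → Coprime m (n * o)
coprime-* {m} {n} m⊥n m⊥o {d} (d∣m , d∣n*o) = m⊥o (d∣m , coprime-divisor d⊥n d∣n*o)
  where
  d⊥n : Coprime d n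
  d⊥n (e∣d , e∣n) = m⊥n (∣-trans e∣d d∣m , e∣n)

coprime-^ : ∀ {m n} → Coprime m n → ∀ a → Coprime m (n ^ a)
coprime-^ _   zero    (_ , d∣1) = ∣1⇒≡1 d∣1
coprime-^ m⊥n (suc a) = coprime-* m⊥n (coprime-^ m⊥n a)

prime∤⇒coprime : ∀ {p n} → Prime p → ¬ p ∣ n → Coprime n p
prime∤⇒coprime p-prime p∤n (d∣n , d∣p) with prime⇒irreducible p-prime d∣p
... | inj₁ d≡1 = d≡1
... | inj₂ refl = contradiction d∣n p∤n

factorOut : ∀ {p n} → 1 < p → 0 < n → p ∣ n → ∃₂ λ a r → n ≡ p ^ suc a * r × ¬ p ∣ r
factorOut {p} {n} 1<p 0<n = go n (<-wellFounded n) 0<n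
  where
  go : ∀ m → Acc _<_ m → 0 < m → p ∣ m → ∃₂ λ a r → m ≡ p ^ suc a * r × ¬ p ∣ r
  go m (acc rec) 0<m p∣m with p ∣? quotient p∣m
  ... | no p∤q = 0 , q , trans (m∣n⇒n≡m*quotient p∣m) (cong (_* q) (sym (*-identityʳ p))) , p∤q
    where q = quotient p∣m
  ... | yes p∣q with go q (rec q<m) 0<q p∣q
    where
    q = quotient p∣m
    q<m : q < m
    q<m = quotient-< p∣m {{n>1⇒nonTrivial 1<p}} {{>-nonZero 0<m}}
    0<q : 0 < q
    0<q = >-nonZero⁻¹ q {{quotient≢0 p∣m {{>-nonZero 0<m}}}}
  ...   | a , r , q≡p^[1+a]*r , p∤r = suc a , r , m≡ , p∤r
    where
    open ≡-Reasoning
    m≡ : m ≡ p ^ suc (suc a) * r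
    m≡ = begin
      m                    ≡⟨ m∣n⇒n≡m*quotient p∣m ⟩
      p * quotient p∣m     ≡⟨ cong (p *_) q≡p^[1+a]*r ⟩
      p * (p ^ suc a * r)  ≡⟨ *-assoc p (p ^ suc a) r ⟨
      p ^ suc (suc a) * r  ∎

iter-suc : ∀ f k n → iter f (suc k) n ≡ iter f k (f n)
iter-suc f zero    n = refl
iter-suc f (suc k) n = cong f (iter-suc f k n)

iter-fixedPoint : ∀ f {x} → f x ≡ x → ∀ k → iter f k x ≡ x
iter-fixedPoint f fx≡x zero    = refl
iter-fixedPoint f fx≡x (suc k) = trans (cong f (iter-fixedPoint f fx≡x k)) fx≡x

module ψ-Properties {f : ℕ → ℕ} (ψ : IsPsiBar f) where
  open IsPsiBar ψ

  ψ-primePower-* : ∀ {p r} a → Prime p → ¬ p ∣ r → 0 < r → f (p ^ suc a * r) ≡ f (p ^ suc a) * f r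
  ψ-primePower-* {p} a p-prime p∤r 0<r =
    mult _ _ (m^n>0 p {{prime⇒nonZero p-prime}} (suc a)) 0<r
      (coprime-sym (coprime-^ (prime∤⇒coprime p-prime p∤r) (suc a)))

  <ψ-oddPrimePower-* : ∀ {p r} a → Prime p → ¬ 2 ∣ p → ¬ p ∣ r → 0 < r → r ≤ f r →
                       p ^ suc a * r < f (p ^ suc a * r)
  <ψ-oddPrimePower-* {p} {r} a p-prime 2∤p p∤r 0<r r≤ψr = begin-strict
    p ^ suc a * r                ≡⟨ *-assoc p (p ^ a) r ⟩
    p * (p ^ a * r)              <⟨ m<m+n _ (*-mono-≤ (m^n>0 p {{prime⇒nonZero p-prime}} a) 0<r) ⟩
    p * (p ^ a * r) + p ^ a * r  ≡⟨ distrib (p ^ a) r p ⟩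
    p ^ a * (p + 1) * r          ≤⟨ *-monoʳ-≤ (p ^ a * (p + 1)) r≤ψr ⟩
    p ^ a * (p + 1) * f r        ≡⟨ cong (_* f r) (oddPrime p (suc a) p-prime 2∤p (s≤s z≤n)) ⟨
    f (p ^ suc a) * f r          ≡⟨ ψ-primePower-* a p-prime p∤r 0<r ⟨
    f (p ^ suc a * r)            ∎
    where
    open ≤-Reasoning
    open +-*-Solver
    distrib : ∀ x r p → p * (x * r) + x * r ≡ x * (p + 1) * r
    distrib = solve 3 (λ x r p → p :* (x :* r) :+ x :* r := x :* (p :+ con 1) :* r) refl

  mutual
    odd⇒≤ψ : ∀ {n} → Acc _<_ n → 0 < n → ¬ 2 ∣ n → n ≤ f n
    odd⇒≤ψ {1}           _    _ _   = ≤-reflexive (sym one)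
    odd⇒≤ψ {suc (suc _)} accₙ _ 2∤n = <⇒≤ (odd⇒<ψ accₙ (s≤s (s≤s z≤n)) 2∤n)

    odd⇒<ψ : ∀ {n} → Acc _<_ n → 1 < n → ¬ 2 ∣ n → n < f n
    odd⇒<ψ (acc rec) 1<n 2∤n with ∃-prime-divisor 1<n
    ... | p , p-prime , p∣n with factorOut (prime>1 p-prime) (<-trans z<s 1<n) p∣n
    ...   | a , r , refl , p∤r =
      <ψ-oddPrimePower-* a p-prime (λ 2∣p → 2∤n (∣-trans 2∣p p∣n)) p∤r 0<r
        (odd⇒≤ψ (rec (n<m^[1+a]*n a (prime>1 p-prime) 0<r)) 0<r (λ 2∣r → 2∤n (∣n⇒∣m*n (p ^ suc a) 2∣r)))
      where
      0<r : 0 < r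
      0<r = m*n>0⇒n>0 (p ^ suc a) (<-trans z<s 1<n)

  ≤2ψ : ∀ {n} → 0 < n → n ≤ 2 * f n
  ≤2ψ {n} 0<n with 2 ∣? n
  ... | no 2∤n = ≤-trans (odd⇒≤ψ (<-wellFounded n) 0<n 2∤n) (m≤m+n (f n) (f n + 0))
  ... | yes 2∣n with factorOut (s≤s (s≤s z≤n)) 0<n 2∣n
  ...   | a , r , refl , 2∤r = begin
    2 ^ suc a * r        ≤⟨ *-monoʳ-≤ (2 ^ suc a) (odd⇒≤ψ (<-wellFounded r) 0<r 2∤r) ⟩
    2 * 2 ^ a * f r      ≡⟨ *-assoc 2 (2 ^ a) (f r) ⟩
    2 * (2 ^ a * f r)    ≡⟨ cong (λ x → 2 * (x * f r)) (twoPow (suc a) (s≤s z≤n)) ⟨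
    2 * (f (2 ^ suc a) * f r) ≡⟨ cong (2 *_) (ψ-primePower-* a prime[2] 2∤r 0<r) ⟨
    2 * f (2 ^ suc a * r) ∎
    where
    open ≤-Reasoning
    0<r : 0 < r
    0<r = m*n>0⇒n>0 (2 ^ suc a) 0<n

  ψ-pos : ∀ {n} → 0 < n → 0 < f n
  ψ-pos 0<n = m*n>0⇒n>0 2 (≤-trans 0<n (≤2ψ 0<n))

  iter-ψ-2^ : ∀ k → iter f k (2 ^ suc k) ≡ 2
  iter-ψ-2^ zero    = refl
  iter-ψ-2^ (suc k) = trans (iter-suc f k _)
    (trans (cong (iter f k) (twoPow (suc (suc k)) (s≤s z≤n))) (iter-ψ-2^ k))

  iter≡2⇒≤2^ : ∀ k {n} → 0 < n → iter f k n ≡ 2 → n ≤ 2 ^ suc k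
  iter≡2⇒≤2^ zero    _   refl = ≤-refl
  iter≡2⇒≤2^ (suc k) {n} 0<n eq = begin
    n              ≤⟨ ≤2ψ 0<n ⟩
    2 * f n        ≤⟨ *-monoʳ-≤ 2 (iter≡2⇒≤2^ k (ψ-pos 0<n) (trans (sym (iter-suc f k n)) eq)) ⟩
    2 * 2 ^ suc k  ∎
    where open ≤-Reasoning

  odd∧iter≡2⇒<2^ : ∀ k {n} → 0 < n → ¬ 2 ∣ n → iter f k n ≡ 2 → n < 2 ^ k
  odd∧iter≡2⇒<2^ zero    _ 2∤2 refl = contradiction ∣-refl 2∤2
  odd∧iter≡2⇒<2^ (suc k) {1} _ _ eq = contradiction (trans (sym (iter-fixedPoint f one (suc k))) eq) λ ()
  odd∧iter≡2⇒<2^ (suc k) {n@(suc (suc _))} 0<n 2∤n eq =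
    <-≤-trans (odd⇒<ψ (<-wellFounded n) (s≤s (s≤s z≤n)) 2∤n)
              (iter≡2⇒≤2^ k (ψ-pos 0<n) (trans (sym (iter-suc f k n)) eq))

theorem2p3 : (f : ℕ → ℕ) → IsPsiBar f → (k : ℕ) → 1 < k →
    (HasLambda f (2 ^ (k + 1)) k
      × (∀ n → 0 < n → 2 ∣ n → HasLambda f n k → n ≤ 2 ^ (k + 1)))
    × (∀ n → 0 < n → ¬ (2 ∣ n) → HasLambda f n k → n < 2 ^ k)
theorem2p3 f ψ k 1<k rewrite +-comm k 1 = (λ[2^[1+k]]≡k , even-bound) , odd-bound
  where
  open ψ-Properties ψ
  λ[2^[1+k]]≡k : HasLambda f (2 ^ suc k) k
  λ[2^[1+k]]≡k = inj₂ (^-monoʳ-< 2 (s≤s (s≤s z≤n)) {0} {suc k} z<s , iter-ψ-2^ k)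
  even-bound : ∀ n → 0 < n → 2 ∣ n → HasLambda f n k → n ≤ 2 ^ suc k
  even-bound n _   2∣n (inj₁ (refl , _)) = contradiction (∣1⇒≡1 2∣n) λ ()
  even-bound n 0<n _   (inj₂ (_ , eq))   = iter≡2⇒≤2^ k 0<n eq
  odd-bound : ∀ n → 0 < n → ¬ (2 ∣ n) → HasLambda f n k → n < 2 ^ k
  odd-bound n _   _   (inj₁ (_ , k≡0)) = contradiction (subst (1 <_) k≡0 1<k) λ ()
  odd-bound n 0<n 2∤n (inj₂ (_ , eq))  = odd∧iter≡2⇒<2^ k 0<n 2∤n eq
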